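{- Let $n>k>0$. The tight-span of any matroid subdivision of $\Delta(k,n)$ is at most $(k-1)$-dimensional; equivalently, every interior cell of a matroid subdivision of $\Delta(k,n)$ has dimension at least $n-k$.
   Context: $\Delta(k,n)=\operatorname{conv}\{\sum_{i\in\sigma}e_i:\sigma\in\binom{[n]}{k}\}$ has dimension $n-1$. A matroid subdivision is a polytopal subdivision of $\Delta(k,n)$ (without new vertices) all of whose cells are matroid polytopes, i.e. subpolytopes all of whose edges are parallel to vectors $e_i-e_j$. The tight-span of a subdivision $\Sigma$ of an $m$-dimensional polytope is the poset of interior cells (cells not contained in the boundary) under reverse inclusion, viewed as a cell complex in which an interior cell of dimension $m-\ell$ corresponds to an $\ell$-dimensional cell. -}

module Defs where

open import Data.Nat using (ℕ; zero; suc) renaming (_+_ to _+ℕ_; _∸_ to _∸ℕ_)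
open import Data.Fin using (Fin; zero; suc)
open import Data.Fin.Subset using (Subset; Side; inside; outside; ∣_∣)
open import Data.Vec using (lookup)
open import Data.List using (List; length)
import Data.List as L
open import Data.List.Membership.Propositional using (_∈_)
open import Data.Rational using (ℚ; 0ℚ; 1ℚ; _+_; _*_; _-_; _≤_)
open import Data.Product using (Σ; ∃; _×_)
open import Data.Sum using (_⊎_)
open import Data.Empty using (⊥)
open import Relation.Nullary using (¬_)
open import Relation.Binary.PropositionalEquality using (_≡_; _≢_)
open import Function.Bundles using (_⇔_)

-- Vertices of Δ(k,n) are the 0/1-vectors Σ_{i∈σ} e_i, σ a k-subset of [n].
-- We represent a 0/1 vector by the subset σ (Data.Fin.Subset), and a cell
-- (a polytope without new vertices) by a finite list of such vertices
-- (the cell is its convex hull).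

Point : ℕ → Set
Point n = Fin n → ℚ

sideℚ : Side → ℚ
sideℚ inside  = 1ℚ
sideℚ outside = 0ℚ

embed : ∀ {n} → Subset n → Point n
embed σ j = sideℚ (lookup σ j)

e : ∀ {n} → Fin n → Point n
e i j with i Data.Fin.≟ j
... | Relation.Nullary.yes _ = 1ℚ
... | Relation.Nullary.no  _ = 0ℚ

sumᶠ : ∀ {m} → (Fin m → ℚ) → ℚ
sumᶠ {zero}  f = 0ℚ
sumᶠ {suc m} f = f zero + sumᶠ (λ i → f (suc i))

dot : ∀ {n} → Point n → Point n → ℚ
dot c x = sumᶠ (λ j → c j * x j)

Cell : ℕ → Set
Cell n = List (Subset n)

InConv : ∀ {n} → Cell n → Point n → Set
InConv {n} C x =
  Σ (Fin (length C) → ℚ) λ w →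
    (∀ i → 0ℚ ≤ w i) × (sumᶠ w ≡ 1ℚ) ×
    (∀ j → sumᶠ (λ i → w i * embed (L.lookup C i) j) ≡ x j)

Maximises : ∀ {n} → Point n → Cell n → Subset n → Set
Maximises c C v = ∀ u → u ∈ C → dot c (embed u) ≤ dot c (embed v)

IsFace : ∀ {n} → Cell n → Cell n → Set
IsFace {n} F C = Σ (Point n) λ c → ∀ v → (v ∈ F) ⇔ (v ∈ C × Maximises c C v)

IsFace₀ : ∀ {n} → Cell n → Cell n → Set
IsFace₀ F C = IsFace F C ⊎ (∀ v → v ∈ F → ⊥)

IsEdge : ∀ {n} → Subset n → Subset n → Cell n → Set
IsEdge {n} u v C = (u ≢ v) × Σ (Point n) λ c →
  ∀ w → (w ≡ u ⊎ w ≡ v) ⇔ (w ∈ C × Maximises c C w)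

ParallelToRoot : ∀ {n} → Point n → Set
ParallelToRoot {n} x = Σ (Fin n) λ i → Σ (Fin n) λ j → (i ≢ j) ×
  Σ ℚ λ t → ∀ l → x l ≡ t * (e i l - e j l)

IsMatroidPolytope : ∀ {n} → Cell n → Set
IsMatroidPolytope C = ∀ u v → IsEdge u v C →
  ParallelToRoot (λ l → embed u l - embed v l)

IsHVertex : ∀ {n} → ℕ → Subset n → Set
IsHVertex k v = ∣ v ∣ ≡ k

-- polytopal subdivision of Δ(k,n) without new vertices, all of whose cells
-- are matroid polytopes.  Σ lists all cells of the polyhedral complex
-- (closed under taking nonempty faces).
record IsMatroidSubdivision {n} (k : ℕ) (S : List (Cell n)) : Set where
  field
    vertices   : ∀ C → C ∈ S → ∀ v → v ∈ C → IsHVertex k v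
    nonempty   : ∀ C → C ∈ S → Σ (Subset n) λ v → v ∈ C
    faceClosed : ∀ C → C ∈ S → ∀ F → IsFace F C → Σ (Cell n) λ F' → F' ∈ S × (∀ v → (v ∈ F') ⇔ (v ∈ F))
    intersect  : ∀ C → C ∈ S → ∀ C' → C' ∈ S →
                 Σ (Cell n) λ F → IsFace₀ F C × IsFace₀ F C' ×
                   (∀ x → InConv C x → InConv C' x → InConv F x)
    covers     : ∀ (V : Cell n) → (∀ v → v ∈ V → IsHVertex k v) →
                 ∀ x → InConv V x → Σ (Cell n) λ C → C ∈ S × InConv C x
    matroid    : ∀ C → C ∈ S → IsMatroidPolytope C

MaximisesΔ : ∀ {n} → ℕ → Point n → Subset n → Set
MaximisesΔ k c v = ∀ u → IsHVertex k u → dot c (embed u) ≤ dot c (embed v)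

-- C is contained in a proper face of Δ(k,n) (i.e. in its boundary)
InBoundary : ∀ {n} → ℕ → Cell n → Set
InBoundary {n} k C = Σ (Point n) λ c →
  (∀ v → v ∈ C → MaximisesΔ k c v) ×
  Σ (Subset n) λ w → IsHVertex k w × ¬ MaximisesΔ k c w

IsInterior : ∀ {n} → ℕ → Cell n → Set
IsInterior k C = ¬ InBoundary k C

AffinelyIndependent : ∀ {n} → Cell n → Set
AffinelyIndependent {n} L = ∀ (w : Fin (length L) → ℚ) → sumᶠ w ≡ 0ℚ →
  (∀ j → sumᶠ (λ i → w i * embed (L.lookup L i) j) ≡ 0ℚ) → ∀ i → w i ≡ 0ℚ

DimAtLeast : ∀ {n} → Cell n → ℕ → Set
DimAtLeast {n} C d = Σ (Cell n) λ L → (length L ≡ suc d) ×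
  (∀ v → v ∈ L → v ∈ C) × AffinelyIndependent L

-- Fix an interior cell C and a vertex u of C.  For each of the n − k
-- coordinates j ∉ u we find an exchange partner g ∈ C with g ∖ u = {j}:
-- C is interior, so some vertex of C contains j (`interior-covers`); a vertex
-- g ∋ j with |g ∩ u| maximal spans an edge with u, being cut out by the
-- functional (k+1)·χ_u + χ_g + k(k − |g ∩ u|)·e_j (`exchange-edge`); as C is
-- a matroid polytope u − g is parallel to a root e_i − e_i′, and such a
-- vector has at most one coordinate −1 (`root-neg-unique`), so g ∖ u = {j}.
-- Then u and its partners are affinely independent, since the partner for j
-- is the only one containing j (`diagonal-independent`, `partners-span`).
module Submission where

open import Defs
open import Data.Nat using (ℕ; zero; suc; _+_; _*_; _∸_; _≤_; _<_; z≤n; s≤s; _≤?_)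
import Data.Nat.Properties as ℕₚ
open import Data.Nat.Tactic.RingSolver using (solve-∀)
open import Data.Fin as Fin using (Fin; zero; suc)
import Data.Fin.Properties as Finₚ
open import Data.Fin.Subset using (Subset; Side; inside; outside; ∣_∣; ∁; ⊤)
open import Data.Fin.Subset.Properties using (∣⊤∣≡n; ∣∁p∣≡n∸∣p∣)
open import Data.Vec using ([]; _∷_; lookup)
import Data.Vec.Properties as Vecₚ
import Data.Bool.Properties as Boolₚ
open import Data.List using (List; length; []; _∷_; filter)
import Data.List as List
import Data.List.Properties as Listₚ
open import Data.List.Relation.Unary.Any using (here; there; any?)
import Data.List.Relation.Unary.All as All
open import Data.List.Membership.Propositional using (_∈_; find; lose)
open import Data.List.Membership.Propositional.Properties
  using (∈-tabulate⁻; ∈-filter⁺; ∈-filter⁻)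
open import Data.List.Extrema.Nat using (argmax; argmax-all; f[xs]≤f[argmax])
open import Data.Rational as ℚ using (ℚ; 0ℚ; 1ℚ; _-_; -_)
import Data.Rational.Properties as ℚₚ
open import Data.Integer using (+<+)
open import Data.Product as Product using (Σ; _×_; _,_; proj₁; proj₂)
open import Data.Sum using (_⊎_; inj₁; inj₂)
open import Data.Empty using (⊥; ⊥-elim)
open import Function using (_∘_; id)
open import Function.Bundles using (mk⇔)
open import Relation.Nullary using (¬_; yes; no)
open import Relation.Unary using (Decidable)
open import Relation.Binary.Definitions using (DecidableEquality)
open import Relation.Binary.PropositionalEquality

⟦_⟧ : Side → ℕ
⟦ inside  ⟧ = 1
⟦ outside ⟧ = 0

val : ∀ {n} → (Fin n → ℕ) → Subset n → ℕ
val a []      = 0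
val a (x ∷ v) = a zero * ⟦ x ⟧ + val (a ∘ suc) v

χ : ∀ {n} → Subset n → Fin n → ℕ
χ w l = ⟦ lookup w l ⟧

shared : ∀ {n} → Subset n → Subset n → ℕ
shared v w = val (χ w) v

val-+ : ∀ {n} (a b : Fin n → ℕ) (v : Subset n) →
  val (λ l → a l + b l) v ≡ val a v + val b v
val-+ a b []      = refl
val-+ a b (x ∷ v) rewrite val-+ (a ∘ suc) (b ∘ suc) v
                        | ℕₚ.*-distribʳ-+ ⟦ x ⟧ (a zero) (b zero) =
  shuffle (a zero * ⟦ x ⟧) (b zero * ⟦ x ⟧) _ _
  where
  shuffle : ∀ p q r s → p + q + (r + s) ≡ p + r + (q + s)
  shuffle = solve-∀

val-* : ∀ {n} (c : ℕ) (a : Fin n → ℕ) (v : Subset n) →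
  val (λ l → c * a l) v ≡ c * val a v
val-* c a []      = sym (ℕₚ.*-zeroʳ c)
val-* c a (x ∷ v) rewrite val-* c (a ∘ suc) v | ℕₚ.*-assoc c (a zero) ⟦ x ⟧ =
  sym (ℕₚ.*-distribˡ-+ c (a zero * ⟦ x ⟧) _)

shared-sym : ∀ {n} (v w : Subset n) → shared v w ≡ shared w v
shared-sym []      []      = refl
shared-sym (x ∷ v) (y ∷ w) = cong₂ _+_ (ℕₚ.*-comm ⟦ y ⟧ ⟦ x ⟧) (shared-sym v w)

shared-self : ∀ {n} (v : Subset n) → shared v v ≡ ∣ v ∣
shared-self []            = refl
shared-self (inside ∷ v)  = cong suc (shared-self v)
shared-self (outside ∷ v) = shared-self v

shared-≤ : ∀ {n} (v w : Subset n) → shared v w ≤ ∣ v ∣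
shared-≤ []            []            = z≤n
shared-≤ (inside ∷ v)  (inside ∷ w)  = s≤s (shared-≤ v w)
shared-≤ (inside ∷ v)  (outside ∷ w) = ℕₚ.m≤n⇒m≤1+n (shared-≤ v w)
shared-≤ (outside ∷ v) (inside ∷ w)  = shared-≤ v w
shared-≤ (outside ∷ v) (outside ∷ w) = shared-≤ v w

shared-≤ʳ : ∀ {n} (v w : Subset n) → shared v w ≤ ∣ w ∣
shared-≤ʳ v w = subst (_≤ ∣ w ∣) (shared-sym w v) (shared-≤ w v)

shared-full : ∀ {n} (v w : Subset n) → ∣ v ∣ ≡ ∣ w ∣ → shared v w ≡ ∣ v ∣ → v ≡ w
shared-full []            []            _ _ = refl
shared-full (inside ∷ v)  (inside ∷ w)  c o =
  cong (inside ∷_) (shared-full v w (ℕₚ.suc-injective c) (ℕₚ.suc-injective o))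
shared-full (inside ∷ v)  (outside ∷ w) c o = ⊥-elim (ℕₚ.<-irrefl o (s≤s (shared-≤ v w)))
shared-full (outside ∷ v) (inside ∷ w)  c o =
  ⊥-elim (ℕₚ.<-irrefl refl (subst (_≤ ∣ w ∣) (trans o c) (shared-≤ʳ v w)))
shared-full (outside ∷ v) (outside ∷ w) c o = cong (outside ∷_) (shared-full v w c o)

shared-< : ∀ {n} (v w : Subset n) → ∣ v ∣ ≡ ∣ w ∣ → v ≢ w → shared v w < ∣ v ∣
shared-< v w c v≢w = ℕₚ.≤∧≢⇒< (shared-≤ v w) (v≢w ∘ shared-full v w c)

δ : ∀ {n} → Fin n → Fin n → ℕ
δ zero    zero    = 1
δ zero    (suc _) = 0
δ (suc _) zero    = 0
δ (suc j) (suc l) = δ j l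

δᶜ : ∀ {n} → Fin n → Fin n → ℕ
δᶜ zero    zero    = 0
δᶜ zero    (suc _) = 1
δᶜ (suc _) zero    = 1
δᶜ (suc j) (suc l) = δᶜ j l

val-0 : ∀ {n} (v : Subset n) → val (λ _ → 0) v ≡ 0
val-0 []      = refl
val-0 (x ∷ v) = val-0 v

val-1 : ∀ {n} (v : Subset n) → val (λ _ → 1) v ≡ ∣ v ∣
val-1 []            = refl
val-1 (inside ∷ v)  = cong suc (val-1 v)
val-1 (outside ∷ v) = val-1 v

val-δ : ∀ {n} (j : Fin n) (v : Subset n) → val (δ j) v ≡ ⟦ lookup v j ⟧
val-δ zero    (x ∷ v) rewrite val-0 v =
  trans (ℕₚ.+-identityʳ _) (ℕₚ.*-identityˡ ⟦ x ⟧)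
val-δ (suc j) (x ∷ v) = val-δ j v

val-δᶜ : ∀ {n} (j : Fin n) (v : Subset n) → val (δᶜ j) v + ⟦ lookup v j ⟧ ≡ ∣ v ∣
val-δᶜ zero    (inside ∷ v)  rewrite val-1 v = ℕₚ.+-comm ∣ v ∣ 1
val-δᶜ zero    (outside ∷ v) rewrite val-1 v = ℕₚ.+-identityʳ ∣ v ∣
val-δᶜ (suc j) (inside ∷ v)  = cong suc (val-δᶜ j v)
val-δᶜ (suc j) (outside ∷ v) = val-δᶜ j v

toℚ : ℕ → ℚ
toℚ zero    = 0ℚ
toℚ (suc m) = 1ℚ ℚ.+ toℚ m

toℚ-+ : ∀ a b → toℚ (a + b) ≡ toℚ a ℚ.+ toℚ b
toℚ-+ zero    b = sym (ℚₚ.+-identityˡ (toℚ b))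
toℚ-+ (suc a) b = trans (cong (1ℚ ℚ.+_) (toℚ-+ a b)) (sym (ℚₚ.+-assoc 1ℚ (toℚ a) (toℚ b)))

toℚ-suc : ∀ m → toℚ m ℚ.< toℚ (suc m)
toℚ-suc m = subst (ℚ._< 1ℚ ℚ.+ toℚ m) (ℚₚ.+-identityˡ (toℚ m))
                  (ℚₚ.+-monoˡ-< (toℚ m) 0<1)
  where
  0<1 : 0ℚ ℚ.< 1ℚ
  0<1 = ℚ.*<* (+<+ (s≤s z≤n))

toℚ-mono-≤ : ∀ {a b} → a ≤ b → toℚ a ℚ.≤ toℚ b
toℚ-mono-≤ {b = zero}  z≤n     = ℚₚ.≤-refl
toℚ-mono-≤ {b = suc b} z≤n     = ℚₚ.≤-trans (toℚ-mono-≤ {b = b} z≤n) (ℚₚ.<⇒≤ (toℚ-suc b))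
toℚ-mono-≤ (s≤s a≤b) = ℚₚ.+-monoʳ-≤ 1ℚ (toℚ-mono-≤ a≤b)

toℚ-cancel-≤ : ∀ {a b} → toℚ a ℚ.≤ toℚ b → a ≤ b
toℚ-cancel-≤ {a} {b} q = ℕₚ.≮⇒≥ λ b<a →
  ℚₚ.<-irrefl refl (ℚₚ.<-≤-trans (ℚₚ.<-≤-trans (toℚ-suc b) (toℚ-mono-≤ b<a)) q)

lift : ∀ {n} → (Fin n → ℕ) → Point n
lift a l = toℚ (a l)

dot-lift : ∀ {n} (a : Fin n → ℕ) (v : Subset n) → dot (lift a) (embed v) ≡ toℚ (val a v)
dot-lift a []      = refl
dot-lift a (x ∷ v) =
  trans (cong₂ ℚ._+_ (term (a zero) x) (dot-lift (a ∘ suc) v))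
        (sym (toℚ-+ (a zero * ⟦ x ⟧) _))
  where
  term : ∀ c x → toℚ c ℚ.* sideℚ x ≡ toℚ (c * ⟦ x ⟧)
  term c inside  = trans (ℚₚ.*-identityʳ (toℚ c)) (cong toℚ (sym (ℕₚ.*-identityʳ c)))
  term c outside = trans (ℚₚ.*-zeroʳ (toℚ c)) (cong toℚ (sym (ℕₚ.*-zeroʳ c)))

dot-lift-≤ : ∀ {n} (a : Fin n → ℕ) (v w : Subset n) →
  val a v ≤ val a w → dot (lift a) (embed v) ℚ.≤ dot (lift a) (embed w)
dot-lift-≤ a v w le = subst₂ ℚ._≤_ (sym (dot-lift a v)) (sym (dot-lift a w)) (toℚ-mono-≤ le)

dot-lift-≤⁻ : ∀ {n} (a : Fin n → ℕ) (v w : Subset n) →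
  dot (lift a) (embed v) ℚ.≤ dot (lift a) (embed w) → val a v ≤ val a w
dot-lift-≤⁻ a v w le = toℚ-cancel-≤ (subst₂ ℚ._≤_ (dot-lift a v) (dot-lift a w) le)

edge-by-functional : ∀ {n} (C : Cell n) {u g : Subset n} (a : Fin n → ℕ) →
  u ≢ g → u ∈ C → g ∈ C → val a g ≡ val a u →
  (∀ v → v ∈ C → v ≢ u → v ≢ g → val a v < val a u) → IsEdge u g C
edge-by-functional {n} C {u} {g} a u≢g u∈C g∈C g≈u below = u≢g , lift a , λ w → mk⇔ (to w) (from w)
  where
  _≟ˢ_ : DecidableEquality (Subset n)
  _≟ˢ_ = Vecₚ.≡-dec Boolₚ._≟_

  at-most-u : ∀ v → v ∈ C → val a v ≤ val a u
  at-most-u v v∈C with v ≟ˢ u | v ≟ˢ g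
  ... | yes refl | _        = ℕₚ.≤-refl
  ... | no _     | yes refl = ℕₚ.≤-reflexive g≈u
  ... | no v≢u   | no v≢g   = ℕₚ.<⇒≤ (below v v∈C v≢u v≢g)

  maximal : ∀ w → val a w ≡ val a u → Maximises (lift a) C w
  maximal w w≈u v v∈C = dot-lift-≤ a v w (subst (val a v ≤_) (sym w≈u) (at-most-u v v∈C))

  to : ∀ w → w ≡ u ⊎ w ≡ g → w ∈ C × Maximises (lift a) C w
  to w (inj₁ refl) = u∈C , maximal u refl
  to w (inj₂ refl) = g∈C , maximal g g≈u

  from : ∀ w → w ∈ C × Maximises (lift a) C w → w ≡ u ⊎ w ≡ g
  from w (w∈C , max) with w ≟ˢ u | w ≟ˢ g
  ... | yes w≡u | _       = inj₁ w≡u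
  ... | no _    | yes w≡g = inj₂ w≡g
  ... | no w≢u  | no w≢g  =
    ⊥-elim (ℕₚ.<⇒≱ (below w w∈C w≢u w≢g) (dot-lift-≤⁻ a u w (max u u∈C)))

exchange : ∀ {n} (k : ℕ) (u g : Subset n) (j : Fin n) → Fin n → ℕ
exchange k u g j l = suc k * χ u l + χ g l + k * (k ∸ shared g u) * δ j l

val-exchange : ∀ {n} k (u g : Subset n) j (v : Subset n) →
  val (exchange k u g j) v ≡
    suc k * shared v u + shared v g + k * (k ∸ shared g u) * ⟦ lookup v j ⟧
val-exchange k u g j v = begin
  val (exchange k u g j) v
    ≡⟨ val-+ (λ l → suc k * χ u l + χ g l) (λ l → K * δ j l) v ⟩
  val (λ l → suc k * χ u l + χ g l) v + val (λ l → K * δ j l) v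
    ≡⟨ cong₂ _+_ (val-+ (λ l → suc k * χ u l) (χ g) v) (val-* K (δ j) v) ⟩
  val (λ l → suc k * χ u l) v + shared v g + K * val (δ j) v
    ≡⟨ cong₂ (λ p q → p + shared v g + K * q) (val-* (suc k) (χ u) v) (val-δ j v) ⟩
  suc k * shared v u + shared v g + K * ⟦ lookup v j ⟧ ∎
  where
  open ≡-Reasoning
  K : ℕ
  K = k * (k ∸ shared g u)

exchange-balance : ∀ k m → m ≤ k → suc k * m + k + k * (k ∸ m) * 1 ≡ suc k * k + m
exchange-balance k m m≤k with ℕₚ.m≤n⇒∃[o]m+o≡n m≤k
... | d , refl rewrite ℕₚ.m+n∸m≡n m d = balance m d
  where
  balance : ∀ m d → suc (m + d) * m + (m + d) + (m + d) * d * 1 ≡ suc (m + d) * (m + d) + m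
  balance = solve-∀

exchange-below-u : ∀ k p q m K → p < k → q ≤ k → suc k * p + q + K * 0 < suc k * k + m
exchange-below-u k p q m K p<k q≤k rewrite ℕₚ.*-zeroʳ K | ℕₚ.+-identityʳ (suc k * p + q) = begin-strict
  suc k * p + q       <⟨ ℕₚ.+-monoʳ-< (suc k * p) (s≤s q≤k) ⟩
  suc k * p + suc k   ≡⟨ ℕₚ.+-comm (suc k * p) (suc k) ⟩
  suc k + suc k * p   ≡⟨ ℕₚ.*-suc (suc k) p ⟨
  suc k * suc p       ≤⟨ ℕₚ.*-monoʳ-≤ (suc k) p<k ⟩
  suc k * k           ≤⟨ ℕₚ.m≤m+n _ m ⟩
  suc k * k + m       ∎
  where open ℕₚ.≤-Reasoning

exchange-below-g : ∀ k p q m K → p ≤ m → q < k → suc k * p + q + K < suc k * m + k + K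
exchange-below-g k p q m K p≤m q<k =
  ℕₚ.+-monoˡ-< K (ℕₚ.+-mono-≤-< (ℕₚ.*-monoʳ-≤ (suc k) p≤m) q<k)

exchange-edge : ∀ {n} k (C : Cell n) → (∀ v → v ∈ C → ∣ v ∣ ≡ k) →
  ∀ {u g j} → u ∈ C → lookup u j ≡ outside → g ∈ C → lookup g j ≡ inside →
  (∀ v → v ∈ C → lookup v j ≡ inside → shared v u ≤ shared g u) → IsEdge u g C
exchange-edge {n} k C size {u} {g} {j} u∈C j∉u g∈C j∈g closest =
  edge-by-functional C a u≢g u∈C g∈C (trans value-g (sym value-u)) below
  where
  a : Fin n → ℕ
  a = exchange k u g j

  m K V : ℕ
  m = shared g u
  K = k * (k ∸ m)
  V = suc k * k + m

  m≤k : m ≤ k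
  m≤k = subst (m ≤_) (size g g∈C) (shared-≤ g u)

  value-at : ∀ v s → lookup v j ≡ s → val a v ≡ suc k * shared v u + shared v g + K * ⟦ s ⟧
  value-at v s v-j = trans (val-exchange k u g j v) (cong (λ x → suc k * shared v u + shared v g + K * ⟦ x ⟧) v-j)

  value-u : val a u ≡ V
  value-u = begin
    val a u                                   ≡⟨ value-at u outside j∉u ⟩
    suc k * shared u u + shared u g + K * 0   ≡⟨ cong₂ (λ p q → suc k * p + q + K * 0)
                                                   (trans (shared-self u) (size u u∈C)) (shared-sym u g) ⟩
    V + K * 0                                 ≡⟨ cong (V +_) (ℕₚ.*-zeroʳ K) ⟩
    V + 0                                     ≡⟨ ℕₚ.+-identityʳ V ⟩
    V                                         ∎
    where open ≡-Reasoning

  value-g : val a g ≡ V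
  value-g = begin
    val a g                                   ≡⟨ value-at g inside j∈g ⟩
    suc k * m + shared g g + K * 1            ≡⟨ cong (λ q → suc k * m + q + K * 1)
                                                   (trans (shared-self g) (size g g∈C)) ⟩
    suc k * m + k + K * 1                     ≡⟨ exchange-balance k m m≤k ⟩
    V                                         ∎
    where open ≡-Reasoning

  u≢g : u ≢ g
  u≢g u≡g = outside≢inside (trans (sym j∉u) (trans (cong (λ s → lookup s j) u≡g) j∈g))
    where
    outside≢inside : outside ≢ inside
    outside≢inside ()

  below : ∀ v → v ∈ C → v ≢ u → v ≢ g → val a v < val a u
  below v v∈C v≢u v≢g with lookup v j in v-j
  ... | outside = subst₂ _<_ (sym (value-at v outside v-j)) (sym value-u)
    (exchange-below-u k (shared v u) (shared v g) m K
      (subst (shared v u <_) (size v v∈C) (shared-< v u (trans (size v v∈C) (sym (size u u∈C))) v≢u))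
      (subst (shared v g ≤_) (size v v∈C) (shared-≤ v g)))
  ... | inside = subst₂ _<_ (sym (value-at v inside v-j)) (trans (exchange-balance k m m≤k) (sym value-u))
    (exchange-below-g k (shared v u) (shared v g) m (K * 1) (closest v v∈C v-j)
      (subst (shared v g <_) (size v v∈C) (shared-< v g (trans (size v v∈C) (sym (size g g∈C))) v≢g)))

RootCoordinate : ∀ {n} → Fin n → Fin n → Fin n → Set
RootCoordinate i i′ l =
  (e i l - e i′ l ≡ 0ℚ) ⊎ (l ≡ i × e i l - e i′ l ≡ 1ℚ) ⊎ (l ≡ i′ × e i l - e i′ l ≡ - 1ℚ)

root-coordinate : ∀ {n} {i i′ : Fin n} → i ≢ i′ → ∀ l → RootCoordinate i i′ l
root-coordinate {i = i} {i′} i≢i′ l with i Fin.≟ l | i′ Fin.≟ l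
... | yes refl | yes refl = ⊥-elim (i≢i′ refl)
... | yes refl | no _     = inj₂ (inj₁ (refl , refl))
... | no _     | yes refl = inj₂ (inj₂ (refl , refl))
... | no _     | no _     = inj₁ refl

root-neg-unique : ∀ {n} {x : Point n} → ParallelToRoot x →
  ∀ {j l} → x j ≡ - 1ℚ → x l ≡ - 1ℚ → j ≡ l
root-neg-unique {x = x} (i , i′ , i≢i′ , t , x≡t·root) {j} {l} xj xl =
  compare (root-coordinate i≢i′ j) (root-coordinate i≢i′ l)
  where
  -1≢0 : - 1ℚ ≢ 0ℚ
  -1≢0 ()

  -1≢-1·-1 : - 1ℚ ≢ - 1ℚ ℚ.* - 1ℚ
  -1≢-1·-1 ()

  at : ∀ m {r} → e i m - e i′ m ≡ r → x m ≡ t ℚ.* r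
  at m r≡ = trans (x≡t·root m) (cong (t ℚ.*_) r≡)

  not-zero : ∀ {m} → x m ≡ - 1ℚ → e i m - e i′ m ≢ 0ℚ
  not-zero {m} xm r≡0 = -1≢0 (trans (sym xm) (trans (at m r≡0) (ℚₚ.*-zeroʳ t)))

  -- −1 cannot occur both at i (where x = t) and at i′ (where x = −t)
  not-opposite : ∀ {p q} → x p ≡ - 1ℚ → e i p - e i′ p ≡ 1ℚ →
                 x q ≡ - 1ℚ → e i q - e i′ q ≡ - 1ℚ → ⊥
  not-opposite {p} {q} xp r₁ xq r₂ = -1≢-1·-1 (trans (sym xq) (trans (at q r₂) (cong (ℚ._* - 1ℚ) t≡-1)))
    where
    t≡-1 : t ≡ - 1ℚ
    t≡-1 = trans (sym (ℚₚ.*-identityʳ t)) (trans (sym (at p r₁)) xp)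

  compare : RootCoordinate i i′ j → RootCoordinate i i′ l → j ≡ l
  compare (inj₁ r≡0) _ = ⊥-elim (not-zero xj r≡0)
  compare _ (inj₁ r≡0) = ⊥-elim (not-zero xl r≡0)
  compare (inj₂ (inj₁ (j≡i , _)))  (inj₂ (inj₁ (l≡i , _)))  = trans j≡i (sym l≡i)
  compare (inj₂ (inj₂ (j≡i′ , _))) (inj₂ (inj₂ (l≡i′ , _))) = trans j≡i′ (sym l≡i′)
  compare (inj₂ (inj₁ (_ , r₁))) (inj₂ (inj₂ (_ , r₂))) = ⊥-elim (not-opposite xj r₁ xl r₂)
  compare (inj₂ (inj₂ (_ , r₂))) (inj₂ (inj₁ (_ , r₁))) = ⊥-elim (not-opposite xl r₁ xj r₂)

record Partner {n} (C : Cell n) (u : Subset n) (j : Fin n) : Set where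
  field
    vertex   : Subset n
    vertex∈C : vertex ∈ C
    adds-j   : lookup vertex j ≡ inside
    only-j   : ∀ l → lookup u l ≡ outside → lookup vertex l ≡ inside → l ≡ j

argmax-such-that : ∀ {a p} {A : Set a} {P : A → Set p} → Decidable P → (f : A → ℕ) →
  (xs : List A) → Σ A (λ x → x ∈ xs × P x) →
  Σ A λ g → g ∈ xs × P g × (∀ x → x ∈ xs → P x → f x ≤ f g)
argmax-such-that {A = A} {P} P? f xs (x₀ , x₀∈xs , Px₀) = g , proj₁ g-ok , proj₂ g-ok , maximal
  where
  candidates : List A
  candidates = filter P? xs

  g : A
  g = argmax f x₀ candidates

  g-ok : g ∈ xs × P g
  g-ok = argmax-all f (x₀∈xs , Px₀) (All.tabulate (∈-filter⁻ P?))

  maximal : ∀ x → x ∈ xs → P x → f x ≤ f g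
  maximal x x∈xs Px = All.lookup (f[xs]≤f[argmax] x₀ candidates) (∈-filter⁺ P? x∈xs Px)

exchange-partner : ∀ {n} k (C : Cell n) → (∀ v → v ∈ C → ∣ v ∣ ≡ k) → IsMatroidPolytope C →
  ∀ {u j} → u ∈ C → lookup u j ≡ outside →
  Σ (Subset n) (λ v → v ∈ C × lookup v j ≡ inside) → Partner C u j
exchange-partner k C size matroid {u} {j} u∈C j∉u covered
  with argmax-such-that (λ v → lookup v j Boolₚ.≟ inside) (λ v → shared v u) C covered
... | g , g∈C , j∈g , closest = record { vertex = g ; vertex∈C = g∈C ; adds-j = j∈g ; only-j = only-j }
  where
  root : ParallelToRoot (λ l → embed u l - embed g l)
  root = matroid u g (exchange-edge k C size u∈C j∉u g∈C j∈g closest)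

  minus-one : ∀ {l} → lookup u l ≡ outside → lookup g l ≡ inside → embed u l - embed g l ≡ - 1ℚ
  minus-one l∉u l∈g = cong₂ (λ a b → sideℚ a - sideℚ b) l∉u l∈g

  only-j : ∀ l → lookup u l ≡ outside → lookup g l ≡ inside → l ≡ j
  only-j l l∉u l∈g = root-neg-unique root (minus-one l∉u l∈g) (minus-one j∉u j∈g)

subset-of-size : ∀ {n k} → k ≤ n → Σ (Subset n) λ w → ∣ w ∣ ≡ k
subset-of-size {zero}          z≤n       = [] , refl
subset-of-size {suc n} {zero}  z≤n       = Product.map (outside ∷_) id (subset-of-size {n} z≤n)
subset-of-size {suc n} {suc k} (s≤s k≤n) = Product.map (inside ∷_) (cong suc) (subset-of-size k≤n)

subset-containing : ∀ {n k} (j : Fin n) → 0 < k → k ≤ n →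
  Σ (Subset n) λ w → ∣ w ∣ ≡ k × lookup w j ≡ inside
subset-containing zero (s≤s _) (s≤s k≤n) =
  Product.map (inside ∷_) (λ ∣w∣ → cong suc ∣w∣ , refl) (subset-of-size k≤n)
subset-containing {suc n} {k} (suc j) 0<k k≤1+n with k ≤? n
... | yes k≤n = Product.map (outside ∷_) id (subset-containing j 0<k k≤n)
... | no  k≰n = ⊤ , trans (∣⊤∣≡n (suc n)) (ℕₚ.≤-antisym (ℕₚ.≰⇒> k≰n) k≤1+n)
                  , Vecₚ.lookup-replicate (suc j) inside

-- If no vertex of the nonempty cell C contains j, then C lies in the facet
-- x_j = 0 of Δ(k,n): the functional Σ_{l≠j} x_l equals k on C but only
-- k − 1 at a vertex of Δ(k,n) containing j.  So interior cells cover every j.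
interior-covers : ∀ {n k} (C : Cell n) {u} → u ∈ C → 0 < k → k ≤ n →
  (∀ v → v ∈ C → ∣ v ∣ ≡ k) → IsInterior k C →
  ∀ j → Σ (Subset n) λ v → v ∈ C × lookup v j ≡ inside
interior-covers {n} {k} C {u} u∈C 0<k k≤n size interior j
  with any? (λ v → lookup v j Boolₚ.≟ inside) C
... | yes found = find found
... | no  none  = ⊥-elim (interior (lift (δᶜ j) , on-facet , w , ∣w∣ , off-facet))
  where
  avoids : ∀ v → v ∈ C → lookup v j ≡ outside
  avoids v v∈C with lookup v j in v-j
  ... | outside = refl
  ... | inside  = ⊥-elim (none (lose v∈C v-j))

  value-on-C : ∀ v → v ∈ C → val (δᶜ j) v ≡ k
  value-on-C v v∈C = begin
    val (δᶜ j) v                       ≡⟨ ℕₚ.+-identityʳ _ ⟨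
    val (δᶜ j) v + 0                   ≡⟨ cong (λ s → val (δᶜ j) v + ⟦ s ⟧) (avoids v v∈C) ⟨
    val (δᶜ j) v + ⟦ lookup v j ⟧      ≡⟨ val-δᶜ j v ⟩
    ∣ v ∣                              ≡⟨ size v v∈C ⟩
    k                                  ∎
    where open ≡-Reasoning

  on-facet : ∀ v → v ∈ C → MaximisesΔ k (lift (δᶜ j)) v
  on-facet v v∈C x ∣x∣ = dot-lift-≤ (δᶜ j) x v
    (subst (val (δᶜ j) x ≤_) (sym (value-on-C v v∈C))
      (subst (val (δᶜ j) x ≤_) (trans (val-δᶜ j x) ∣x∣) (ℕₚ.m≤m+n _ _)))

  witness : Σ (Subset n) λ w → ∣ w ∣ ≡ k × lookup w j ≡ inside
  witness = subset-containing j 0<k k≤n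

  w : Subset n
  w = proj₁ witness

  ∣w∣ : ∣ w ∣ ≡ k
  ∣w∣ = proj₁ (proj₂ witness)

  below-k : val (δᶜ j) w < k
  below-k = subst (val (δᶜ j) w <_)
    (trans (cong (λ s → val (δᶜ j) w + ⟦ s ⟧) (sym (proj₂ (proj₂ witness)))) (trans (val-δᶜ j w) ∣w∣))
    (ℕₚ.m<m+n (val (δᶜ j) w) (s≤s z≤n))

  off-facet : ¬ MaximisesΔ k (lift (δᶜ j)) w
  off-facet max = ℕₚ.<⇒≱ below-k
    (subst (_≤ val (δᶜ j) w) (value-on-C u u∈C) (dot-lift-≤⁻ (δᶜ j) u w (max u (size u u∈C))))

sum-zero : ∀ {m} (h : Fin m → ℚ) → (∀ i → h i ≡ 0ℚ) → sumᶠ h ≡ 0ℚ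
sum-zero {zero}  h h≡0 = refl
sum-zero {suc m} h h≡0 =
  trans (cong₂ ℚ._+_ (h≡0 zero) (sum-zero (h ∘ suc) (h≡0 ∘ suc))) (ℚₚ.+-identityˡ 0ℚ)

sum-single : ∀ {m} (h : Fin m → ℚ) (i₀ : Fin m) → (∀ i → i ≢ i₀ → h i ≡ 0ℚ) → sumᶠ h ≡ h i₀
sum-single h zero h≡0 =
  trans (cong (h zero ℚ.+_) (sum-zero (h ∘ suc) (λ i → h≡0 (suc i) λ ())))
        (ℚₚ.+-identityʳ (h zero))
sum-single h (suc i₀) h≡0 =
  trans (cong₂ ℚ._+_ (h≡0 zero λ ())
                     (sum-single (h ∘ suc) i₀ (λ i i≢i₀ → h≡0 (suc i) (i≢i₀ ∘ Finₚ.suc-injective))))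
        (ℚₚ.+-identityˡ _)

diagonal-independent : ∀ {n} (u : Subset n) (M : Cell n) (o : Fin (length M) → Fin n) →
  (∀ t → lookup u (o t) ≡ outside) → (∀ t → lookup (List.lookup M t) (o t) ≡ inside) →
  (∀ t t′ → lookup (List.lookup M t′) (o t) ≡ inside → t′ ≡ t) → AffinelyIndependent (u ∷ M)
diagonal-independent u M o o∉u o∈M o-private w Σw≡0 Σwv≡0 = vanish
  where
  term : Fin (length M) → Fin (length M) → ℚ
  term t i = w (suc i) ℚ.* embed (List.lookup M i) (o t)

  off-diagonal : ∀ t i → i ≢ t → term t i ≡ 0ℚ
  off-diagonal t i i≢t with lookup (List.lookup M i) (o t) in Mi∋ot
  ... | outside = ℚₚ.*-zeroʳ (w (suc i))
  ... | inside  = ⊥-elim (i≢t (o-private t i Mi∋ot))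

  -- coordinate o t of the relation Σᵢ wᵢ vᵢ = 0 reads w_{t+1} = 0
  tail-zero : ∀ t → w (suc t) ≡ 0ℚ
  tail-zero t = begin
    w (suc t)                                        ≡⟨ ℚₚ.*-identityʳ _ ⟨
    w (suc t) ℚ.* 1ℚ                                 ≡⟨ cong (λ s → w (suc t) ℚ.* sideℚ s) (o∈M t) ⟨
    term t t                                         ≡⟨ sum-single (term t) t (off-diagonal t) ⟨
    sumᶠ (term t)                                    ≡⟨ ℚₚ.+-identityˡ _ ⟨
    0ℚ ℚ.+ sumᶠ (term t)                             ≡⟨ cong (ℚ._+ sumᶠ (term t)) head-term ⟨
    w zero ℚ.* embed u (o t) ℚ.+ sumᶠ (term t)       ≡⟨ Σwv≡0 (o t) ⟩
    0ℚ                                               ∎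
    where
    open ≡-Reasoning
    head-term : w zero ℚ.* embed u (o t) ≡ 0ℚ
    head-term = trans (cong (λ s → w zero ℚ.* sideℚ s) (o∉u t)) (ℚₚ.*-zeroʳ (w zero))

  -- and then Σᵢ wᵢ = 0 reads w₀ = 0
  head-zero : w zero ≡ 0ℚ
  head-zero = begin
    w zero                          ≡⟨ ℚₚ.+-identityʳ _ ⟨
    w zero ℚ.+ 0ℚ                   ≡⟨ cong (w zero ℚ.+_) (sum-zero (w ∘ suc) tail-zero) ⟨
    w zero ℚ.+ sumᶠ (w ∘ suc)       ≡⟨ Σw≡0 ⟩
    0ℚ                              ∎
    where open ≡-Reasoning

  vanish : ∀ i → w i ≡ 0ℚ
  vanish zero    = head-zero
  vanish (suc t) = tail-zero t

∁-index : ∀ {n} (v : Subset n) → Fin ∣ ∁ v ∣ → Fin n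
∁-index (inside ∷ v)  t       = suc (∁-index v t)
∁-index (outside ∷ v) zero    = zero
∁-index (outside ∷ v) (suc t) = suc (∁-index v t)

∁-index-outside : ∀ {n} (v : Subset n) t → lookup v (∁-index v t) ≡ outside
∁-index-outside (inside ∷ v)  t       = ∁-index-outside v t
∁-index-outside (outside ∷ v) zero    = refl
∁-index-outside (outside ∷ v) (suc t) = ∁-index-outside v t

∁-index-injective : ∀ {n} (v : Subset n) {t t′} → ∁-index v t ≡ ∁-index v t′ → t ≡ t′
∁-index-injective (inside ∷ v)                   eq = ∁-index-injective v (Finₚ.suc-injective eq)
∁-index-injective (outside ∷ v) {zero}  {zero}   eq = refl
∁-index-injective (outside ∷ v) {suc t} {suc t′} eq =
  cong suc (∁-index-injective v (Finₚ.suc-injective eq))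

lookup-tabulate-cast : ∀ {a} {A : Set a} {m} (f : Fin m → A) (t : Fin (length (List.tabulate f))) →
  List.lookup (List.tabulate f) t ≡ f (Fin.cast (Listₚ.length-tabulate f) t)
lookup-tabulate-cast f t =
  trans (cong (List.lookup (List.tabulate f)) (sym (Finₚ.cast-involutive (sym eq) eq t)))
        (Listₚ.lookup-tabulate f (Fin.cast eq t))
  where eq = Listₚ.length-tabulate f

cast-injective : ∀ {m m′} (eq : m ≡ m′) {t t′ : Fin m} → Fin.cast eq t ≡ Fin.cast eq t′ → t ≡ t′
cast-injective eq {t} {t′} p =
  Finₚ.toℕ-injective (trans (sym (Finₚ.toℕ-cast eq t)) (trans (cong Fin.toℕ p) (Finₚ.toℕ-cast eq t′)))

partners-span : ∀ {n} (C : Cell n) {u} → u ∈ C →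
  (∀ j → lookup u j ≡ outside → Partner C u j) → DimAtLeast C (n ∸ ∣ u ∣)
partners-span {n} C {u} u∈C partner =
  u ∷ M , cong suc (trans eq (∣∁p∣≡n∸∣p∣ u)) , members ,
  diagonal-independent u M o (λ t → ∁-index-outside u (idx t)) o∈M o-private
  where
  partner-at : ∀ t → Partner C u (∁-index u t)
  partner-at t = partner (∁-index u t) (∁-index-outside u t)

  M : Cell n
  M = List.tabulate (Partner.vertex ∘ partner-at)

  eq : length M ≡ ∣ ∁ u ∣
  eq = Listₚ.length-tabulate (Partner.vertex ∘ partner-at)

  idx : Fin (length M) → Fin ∣ ∁ u ∣
  idx = Fin.cast eq

  o : Fin (length M) → Fin n
  o = ∁-index u ∘ idx

  members : ∀ v → v ∈ u ∷ M → v ∈ C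
  members v (here refl) = u∈C
  members v (there v∈M) with ∈-tabulate⁻ v∈M
  ... | t , refl = Partner.vertex∈C (partner-at t)

  o∈M : ∀ t → lookup (List.lookup M t) (o t) ≡ inside
  o∈M t rewrite lookup-tabulate-cast (Partner.vertex ∘ partner-at) t = Partner.adds-j (partner-at (idx t))

  o-private : ∀ t t′ → lookup (List.lookup M t′) (o t) ≡ inside → t′ ≡ t
  o-private t t′ ot∈Mt′ rewrite lookup-tabulate-cast (Partner.vertex ∘ partner-at) t′ =
    sym (cast-injective eq (∁-index-injective u
      (Partner.only-j (partner-at (idx t′)) (o t) (∁-index-outside u (idx t)) ot∈Mt′)))

lemma4p2 : ∀ (k n : ℕ) → 0 < k → k < n → (S : List (Cell n)) → IsMatroidSubdivision k S →
    ∀ C → C ∈ S → IsInterior k C → DimAtLeast C (n ∸ k)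
lemma4p2 k n 0<k k<n S subdivision C C∈S interior
  with IsMatroidSubdivision.nonempty subdivision C C∈S
... | u , u∈C = subst (λ d → DimAtLeast C (n ∸ d)) (size u u∈C) (partners-span C u∈C partner)
  where
  open IsMatroidSubdivision subdivision

  size : ∀ v → v ∈ C → ∣ v ∣ ≡ k
  size = vertices C C∈S

  partner : ∀ j → lookup u j ≡ outside → Partner C u j
  partner j j∉u = exchange-partner k C size (matroid C C∈S) u∈C j∉u
    (interior-covers C u∈C 0<k (ℕₚ.<⇒≤ k<n) size interior j)
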